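{- Let $G$ be a finite simple graph with vertex set $\{v_1,\dots,v_n\}$ having at least one isolated vertex, let $T$ be a minimum twin cover of $G$, and let $u$ be the isolated vertex of $G$ that is not in $T$. Then for $t \geq 1$, the set $\{u_i^s \mid v_i \in T,\ 0 \le s \le t\} \cup \{u^s \mid 1 \le s \le t-1\}$ is a minimum twin cover of $\mu_t(G)$, and it has size $(t+1)|T| + t - 1$. Here $u^s$ denotes the shadow of $u$ at level $s$ in $\mu_t(G)$.
   Context: Two vertices are twins if they have the same open neighborhood. A minimum twin cover of a graph is a minimum size set of vertices containing at least one vertex of every pair of twin vertices; equivalently, it consists of all but one vertex from each class of mutually twin vertices (so all isolated vertices but one belong to it). For a finite simple graph $G$ with $V(G)=\{v_1,\dots,v_n\}$ and $t\ge 1$, the generalized Mycielskian $\mu_t(G)$ has vertex set $\{u_i^s : 1\le i\le n,\ 0\le s\le t\}\cup\{w\}$, where $u_i^0=v_i$ and $u_i^s$ is called the shadow of $v_i$ at level $s$. For each edge $v_iv_j$ of $G$, $\mu_t(G)$ has the edge $u_i^0u_j^0$ and the edges $u_i^su_j^{s+1}$ and $u_j^su_i^{s+1}$ for $0\le s<t$; in addition $u_i^t w$ is an edge for every $i$. There are no other edges. -}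

module Defs where

open import Data.Nat using (ℕ; zero; suc; _*_; _≤_) renaming (_≟_ to _≟ℕ_; _<?_ to _<ℕ?_; _≤?_ to _≤ℕ?_)
open import Data.Fin using (Fin; zero; suc; toℕ; remQuot; _≟_)
open import Data.Fin.Subset using (Subset; _∈_)
open import Data.Bool using (Bool; true; false; _∧_; _∨_)
open import Data.Product using (_×_; _,_)
open import Data.Sum using (_⊎_)
open import Data.Vec using (tabulate; lookup)
open import Relation.Nullary using (¬_)
open import Relation.Nullary.Decidable using (⌊_⌋)
open import Relation.Binary.PropositionalEquality using (_≡_; _≢_)

record SimpleGraph (n : ℕ) : Set where
  field
    adj    : Fin n → Fin n → Bool
    sym    : ∀ i j → adj i j ≡ adj j i
    irrefl : ∀ i → adj i i ≡ false
open SimpleGraph public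

Adjacency : ℕ → Set
Adjacency N = Fin N → Fin N → Bool

Twins : ∀ {N} → Adjacency N → Fin N → Fin N → Set
Twins adj x y = x ≢ y × (∀ z → adj x z ≡ adj y z)

IsTwinCover : ∀ {N} → Adjacency N → Subset N → Set
IsTwinCover adj S = ∀ x y → Twins adj x y → x ∈ S ⊎ y ∈ S

IsMinTwinCover : ∀ {N} → Adjacency N → Subset N → Set
IsMinTwinCover {N} adj S =
  IsTwinCover adj S × (∀ (S' : Subset N) → IsTwinCover adj S' → Data.Fin.Subset.∣ S ∣ ≤ Data.Fin.Subset.∣ S' ∣)

Isolated : ∀ {N} → Adjacency N → Fin N → Set
Isolated adj x = ∀ z → adj x z ≡ false

-- Vertices of μ_t(G), encoded in Fin (suc (suc t * n)):
--   zero        ↦ w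
--   suc x       ↦ u_i^s  where  remQuot n x = (s , i)   (s : Fin (suc t) level, i : Fin n)
MycVertex : ℕ → ℕ → Set
MycVertex t n = Fin (suc (suc t * n))

shadow : ∀ {t n} → Fin (suc t) → Fin n → MycVertex t n
shadow s i = suc (Data.Fin.combine s i)

private
  isZero : ∀ {k} → Fin k → Bool
  isZero zero = true
  isZero (suc _) = false

shadowAdj : ∀ {t n} → SimpleGraph n → Fin (suc t) → Fin n → Fin (suc t) → Fin n → Bool
shadowAdj G s i s' j =
  adj G i j ∧ ((isZero s ∧ isZero s')
               ∨ (⌊ toℕ s' ≟ℕ suc (toℕ s) ⌋ ∨ ⌊ toℕ s ≟ℕ suc (toℕ s') ⌋))

mycielskian : ∀ (t : ℕ) {n} → SimpleGraph n → Adjacency (suc (suc t * n))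
mycielskian t {n} G zero zero = false
mycielskian t {n} G zero (suc y) with remQuot {suc t} n y
... | (s , j) = ⌊ toℕ s ≟ℕ t ⌋
mycielskian t {n} G (suc x) zero with remQuot {suc t} n x
... | (s , i) = ⌊ toℕ s ≟ℕ t ⌋
mycielskian t {n} G (suc x) (suc y) with remQuot {suc t} n x | remQuot {suc t} n y
... | (s , i) | (s' , j) = shadowAdj G s i s' j

coverSet : ∀ (t : ℕ) {n} → Subset n → Fin n → Subset (suc (suc t * n))
coverSet t {n} T u = tabulate f
  where
  f : Fin (suc (suc t * n)) → Bool
  f zero = false
  f (suc x) with remQuot {suc t} n x
  ... | (s , i) = lookup T i ∨ (⌊ i ≟ u ⌋ ∧ (⌊ 1 ≤ℕ? toℕ s ⌋ ∧ ⌊ toℕ s <ℕ? t ⌋))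

-- The apex w is adjacent exactly to the top level, and the neighbourhood of a shadow u_i^s
-- is {w if s = t} ∪ {u_j^s′ | v_i v_j ∈ E, s′ adjacent to s}, where distinct levels have
-- distinct sets of adjacent levels.  So if v_i is not isolated, u_i^s and u_j^s′ are twins
-- only when s = s′ and v_i, v_j are twins in G; shadows of isolated vertices are twins when
-- both or neither lie on the top level.  Hence every pair of twins outside the given set
-- consists of two shadows of u at levels 0 and t, and w tells these apart.
--
-- For minimality, every level of a twin cover S of μ_t(G) is a twin cover of G, hence has
-- at least |T| elements.  The shadows of isolated vertices below level t have no neighbours
-- at all, so they are pairwise twins and S misses at most one of them.  A level containing
-- every isolated vertex has more than |T| elements, because removing u from it leaves a twin
-- cover.  Summing over the levels, |S| ≥ t (|T| + 1) − 1 + |T|.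

module Submission where

open import Defs hiding (sym)
open import Data.Nat using (ℕ; suc; _+_; _*_; _∸_; _≤_)
open import Data.Fin using (Fin)
open import Data.Fin.Subset using (Subset; _∉_; ∣_∣)
open import Data.Product using (_×_)
open import Relation.Binary.PropositionalEquality using (_≡_)

import Data.Bool as Bool
import Data.Fin as Fin
import Data.Nat as ℕ
import Data.Sum as Sum
open import Data.Bool using (Bool; true; false; _∧_; _∨_)
open import Data.Bool.Properties using (∧-conicalˡ; ∧-conicalʳ; ∧-identityʳ; ∧-zeroʳ; ∨-identityʳ; ∨-zeroʳ; ¬-not)
open import Data.Empty using (⊥; ⊥-elim)
open import Data.Fin using (zero; suc; toℕ; quotient; remainder; remQuot; combine; inject₁; fromℕ; _↑ˡ_; _↑ʳ_)
open import Data.Fin.Properties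
  using (suc-injective; any?; all?; <-cmp; toℕ-injective; toℕ-inject₁; toℕ<n; toℕ-fromℕ; toℕ-inject₁-≢;
         inject₁-injective; remQuot-combine; combine-remQuot; combine-injective)
open import Data.Fin.Subset using (_∈_; inside; outside; _-_)
open import Data.Fin.Subset.Properties using (_∈?_; ∣p∣≤∣x∷p∣; x∈p∧x≢y⇒x∈p-y; x∈p⇒∣p-x∣<∣p∣)
open import Data.Nat using (zero; _<_; z≤n; s≤s) renaming (_≟_ to _≟ℕ_; _≤?_ to _≤ℕ?_; _<?_ to _<ℕ?_)
open import Data.Nat.Properties
  using (+-0-monoid; +-mono-≤; +-suc; ≤-<-trans; <-irrefl; ≤-antisym; ≮⇒≥; >⇒≢; m<n⇒m<1+n; ∸-monoˡ-≤;
         module ≤-Reasoning)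
  renaming (suc-injective to suc-injectiveℕ)
open import Data.Nat.Solver using (module +-*-Solver)
open import Data.Product using (_,_; ∃; proj₁; proj₂)
open import Data.Sum using (_⊎_; inj₁; inj₂; [_,_]′)
open import Data.Vec using ([]; _∷_; lookup; tabulate; tail; here; there)
open import Data.Vec.Properties using (lookup∘tabulate; tabulate∘lookup; tabulate-cong; lookup⇒[]=; []=⇒lookup)
open import Function using (_∘_)
open import Relation.Binary using (tri<; tri≈; tri>)
open import Relation.Binary.PropositionalEquality using (refl; sym; trans; cong; cong₂; subst; _≢_; module ≡-Reasoning)
open import Relation.Nullary using (¬_; Dec; yes; no; contradiction)
open import Relation.Nullary.Decidable using (⌊_⌋; _×-dec_; ¬?; decidable-stable; isYes≗does; dec-true; dec-false)

open import Algebra.Properties.Monoid.Sum +-0-monoid using (sum; sum-cong-≗; sum-init-last)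
open +-*-Solver using (solve; _:=_; _:+_; _:*_; con)

module _ {p} {P : Set p} where

  ⌊⌋≡true⇒ : (d : Dec P) → ⌊ d ⌋ ≡ true → P
  ⌊⌋≡true⇒ (yes p) _ = p

  ⌊⌋≡false⇒ : (d : Dec P) → ⌊ d ⌋ ≡ false → ¬ P
  ⌊⌋≡false⇒ (no ¬p) _ = ¬p

  ⇒⌊⌋≡true : (d : Dec P) → P → ⌊ d ⌋ ≡ true
  ⇒⌊⌋≡true d p = trans (isYes≗does d) (dec-true d p)

  ⇒⌊⌋≡false : (d : Dec P) → ¬ P → ⌊ d ⌋ ≡ false
  ⇒⌊⌋≡false d ¬p = trans (isYes≗does d) (dec-false d ¬p)

sum-const : ∀ m c → sum {m} (λ _ → c) ≡ m * c
sum-const zero    c = refl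
sum-const (suc m) c = cong (c +_) (sum-const m c)

sum-mono-≤ : ∀ {m} {f g : Fin m → ℕ} → (∀ i → f i ≤ g i) → sum f ≤ sum g
sum-mono-≤ {zero}  _   = z≤n
sum-mono-≤ {suc m} f≤g = +-mono-≤ (f≤g zero) (sum-mono-≤ (f≤g ∘ suc))

sum-≥-exceptOne : ∀ {m} (g : Fin m → ℕ) c (Bad : Fin m → Set)
                → (∀ i → c ≤ g i) → (∀ i → Bad i ⊎ suc c ≤ g i)
                → (∀ i j → Bad i → Bad j → i ≡ j)
                → m * suc c ≤ suc (sum g)
sum-≥-exceptOne {zero}  g c Bad c≤g bad⊎good unique = z≤n
sum-≥-exceptOne {suc m} g c Bad c≤g bad⊎good unique with bad⊎good zero
... | inj₂ good = subst (suc c + m * suc c ≤_) (+-suc (g zero) _)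
      (+-mono-≤ good (sum-≥-exceptOne (g ∘ suc) c (Bad ∘ suc) (c≤g ∘ suc) (bad⊎good ∘ suc)
                       (λ i j bi bj → suc-injective (unique _ _ bi bj))))
... | inj₁ bad = s≤s (+-mono-≤ (c≤g zero) (subst (_≤ sum (g ∘ suc)) (sum-const m (suc c)) (sum-mono-≤ tail-good)))
  where
  tail-good : ∀ i → suc c ≤ g (suc i)
  tail-good i with bad⊎good (suc i)
  ... | inj₁ bad′ with () ← unique zero (suc i) bad bad′
  ... | inj₂ good = good

∣∣-splitAt : ∀ m {k} (v : Subset (m + k))
           → ∣ v ∣ ≡ ∣ tabulate (λ i → lookup v (i ↑ˡ k)) ∣ + ∣ tabulate (λ j → lookup v (m ↑ʳ j)) ∣
∣∣-splitAt zero    v             = cong ∣_∣ (sym (tabulate∘lookup v))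
∣∣-splitAt (suc m) (outside ∷ v) = ∣∣-splitAt m v
∣∣-splitAt (suc m) (inside  ∷ v) = cong suc (∣∣-splitAt m v)

slice : ∀ {m n} → Subset (m * n) → Fin m → Subset n
slice v s = tabulate (λ i → lookup v (combine s i))

∣∣≡sum-∣slice∣ : ∀ m {n} (v : Subset (m * n)) → ∣ v ∣ ≡ sum {m} (λ s → ∣ slice {n = n} v s ∣)
∣∣≡sum-∣slice∣ zero    []    = refl
∣∣≡sum-∣slice∣ (suc m) {n} v = begin
  ∣ v ∣                                                  ≡⟨ ∣∣-splitAt n {m * n} v ⟩
  ∣ first ∣ + ∣ rest ∣                                    ≡⟨ cong (∣ first ∣ +_) (∣∣≡sum-∣slice∣ m {n} rest) ⟩
  ∣ first ∣ + sum {m} (λ s → ∣ slice {n = n} rest s ∣)    ≡⟨ cong (∣ first ∣ +_) (sum-cong-≗ slice-rest) ⟩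
  ∣ first ∣ + sum {m} (λ s → ∣ slice {n = n} v (suc s) ∣) ∎
  where
  open ≡-Reasoning
  first : Subset n
  first = slice {suc m} v zero
  rest : Subset (m * n)
  rest = tabulate (lookup v ∘ (n ↑ʳ_))
  slice-rest : ∀ (s : Fin m) → ∣ slice {n = n} rest s ∣ ≡ ∣ slice {n = n} v (suc s) ∣
  slice-rest s = cong ∣_∣ (tabulate-cong (λ i → lookup∘tabulate (lookup v ∘ (n ↑ʳ_)) (combine s i)))

∣p∣≡1+∣q∣ : ∀ {n} {p q : Subset n} {x} → x ∈ p → x ∉ q
          → (∀ y → y ≢ x → lookup p y ≡ lookup q y) → ∣ p ∣ ≡ suc ∣ q ∣
∣p∣≡1+∣q∣ {p = inside ∷ p} {outside ∷ q} {zero} _ _ p≐q =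
  cong (suc ∘ ∣_∣) (trans (sym (tabulate∘lookup p))
                   (trans (tabulate-cong (λ y → p≐q (suc y) λ ())) (tabulate∘lookup q)))
∣p∣≡1+∣q∣ {q = inside ∷ q} {zero} _ x∉q _ = ⊥-elim (x∉q here)
∣p∣≡1+∣q∣ {p = b ∷ p} {c ∷ q} {suc x} (there x∈p) x∉q p≐q with p≐q zero (λ ())
... | refl with b
...   | outside = ∣p∣≡1+∣q∣ x∈p (x∉q ∘ there) (λ y y≢x → p≐q (suc y) (y≢x ∘ suc-injective))
...   | inside  = cong suc (∣p∣≡1+∣q∣ x∈p (x∉q ∘ there) (λ y y≢x → p≐q (suc y) (y≢x ∘ suc-injective)))

∧-factors-unique : ∀ {A B : Set} {f g : A → Bool} {r r′ : B → Bool} {a b}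
                 → f a ≡ true → r b ≡ true → (∀ x y → f x ∧ r y ≡ g x ∧ r′ y)
                 → (∀ x → f x ≡ g x) × (∀ y → r y ≡ r′ y)
∧-factors-unique {f = f} {g} {r} {r′} {a} {b} fa rb same = f≗g , r≗r′
  where
  open ≡-Reasoning
  gar′b : g a ∧ r′ b ≡ true
  gar′b = trans (sym (same a b)) (cong₂ _∧_ fa rb)
  f≗g : ∀ x → f x ≡ g x
  f≗g x = begin
    f x        ≡⟨ sym (∧-identityʳ (f x)) ⟩
    f x ∧ true ≡⟨ cong (f x ∧_) (sym rb) ⟩
    f x ∧ r b  ≡⟨ same x b ⟩
    g x ∧ r′ b ≡⟨ cong (g x ∧_) (∧-conicalʳ _ _ gar′b) ⟩
    g x ∧ true ≡⟨ ∧-identityʳ (g x) ⟩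
    g x        ∎
  r≗r′ : ∀ y → r y ≡ r′ y
  r≗r′ y = begin
    r y        ≡⟨ cong (_∧ r y) (sym fa) ⟩
    f a ∧ r y  ≡⟨ same a y ⟩
    g a ∧ r′ y ≡⟨ cong (_∧ r′ y) (∧-conicalˡ _ _ gar′b) ⟩
    r′ y       ∎

module _ {N} {A : Adjacency N} where

  twins-sym : ∀ {x y} → Twins A x y → Twins A y x
  twins-sym (x≢y , same) = x≢y ∘ sym , sym ∘ same

  twin-of-isolated : ∀ {x y} → Twins A x y → Isolated A x → Isolated A y
  twin-of-isolated (_ , same) isoX z = trans (sym (same z)) (isoX z)

  isolated-twins : ∀ {x y} → Isolated A x → Isolated A y → x ≢ y → Twins A x y
  isolated-twins isoX isoY x≢y = x≢y , λ z → trans (isoX z) (sym (isoY z))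

  isolated? : ∀ x → Dec (Isolated A x)
  isolated? x = all? (λ z → A x z Bool.≟ false)

  neighbour-or-isolated : ∀ x → (∃ λ z → A x z ≡ true) ⊎ Isolated A x
  neighbour-or-isolated x with any? (λ z → A x z Bool.≟ true)
  ... | yes nbr  = inj₁ nbr
  ... | no  ¬nbr = inj₂ (λ z → ¬-not (λ e → ¬nbr (z , e)))

  uncovered-isolated-unique : ∀ {S x y} → IsTwinCover A S → Isolated A x → Isolated A y
                            → x ∉ S → y ∉ S → x ≡ y
  uncovered-isolated-unique {x = x} {y} cover isoX isoY x∉S y∉S with x Fin.≟ y
  ... | yes x≡y = x≡y
  ... | no  x≢y with cover x y (isolated-twins isoX isoY x≢y)
  ...   | inj₁ x∈S = contradiction x∈S x∉S
  ...   | inj₂ y∈S = contradiction y∈S y∉S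

  twinCover-minus-isolated : ∀ {S u} → IsTwinCover A S → (∀ x → Isolated A x → x ∈ S)
                           → Isolated A u → IsTwinCover A (S - u)
  twinCover-minus-isolated {u = u} cover iso⊆S isoU x y tw@(x≢y , _) with x Fin.≟ u | y Fin.≟ u
  ... | yes refl | _        = inj₂ (x∈p∧x≢y⇒x∈p-y (iso⊆S y (twin-of-isolated tw isoU)) (x≢y ∘ sym))
  ... | no  _    | yes refl = inj₁ (x∈p∧x≢y⇒x∈p-y (iso⊆S x (twin-of-isolated (twins-sym tw) isoU)) x≢y)
  ... | no  x≢u  | no  y≢u  with cover x y tw
  ...   | inj₁ x∈S = inj₁ (x∈p∧x≢y⇒x∈p-y x∈S x≢u)
  ...   | inj₂ y∈S = inj₂ (x∈p∧x≢y⇒x∈p-y y∈S y≢u)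

  isolated⊆cover⇒∣T∣<∣S∣ : ∀ {T S u} → IsMinTwinCover A T → Isolated A u
                          → IsTwinCover A S → (∀ x → Isolated A x → x ∈ S) → ∣ T ∣ < ∣ S ∣
  isolated⊆cover⇒∣T∣<∣S∣ {S = S} {u} (_ , minimal) isoU cover iso⊆S =
    ≤-<-trans (minimal (S - u) (twinCover-minus-isolated cover iso⊆S isoU)) (x∈p⇒∣p-x∣<∣p∣ (iso⊆S u isoU))

module _ {t : ℕ} where

  -- The level condition of `shadowAdj`, restated because `isZero` is private to Defs.
  levelAdj : Fin (suc t) → Fin (suc t) → Bool
  levelAdj zero zero = true
  levelAdj s    s′   = ⌊ toℕ s′ ≟ℕ suc (toℕ s) ⌋ ∨ ⌊ toℕ s ≟ℕ suc (toℕ s′) ⌋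

  levelBelow : Fin (suc t) → Fin (suc t)
  levelBelow zero    = zero
  levelBelow (suc c) = inject₁ c

  levelAdj-levelBelow : ∀ s → levelAdj s (levelBelow s) ≡ true
  levelAdj-levelBelow zero    = refl
  levelAdj-levelBelow (suc c) = trans (cong (⌊ toℕ (inject₁ c) ≟ℕ suc (toℕ (suc c)) ⌋ ∨_) one-above) (∨-zeroʳ _)
    where
    one-above : ⌊ suc (toℕ c) ≟ℕ suc (toℕ (inject₁ c)) ⌋ ≡ true
    one-above = ⇒⌊⌋≡true (_ ≟ℕ _) (cong ℕ.suc (sym (toℕ-inject₁ c)))

  levelAdj-separates : ∀ {s s′} → s Fin.< s′ → ∃ λ b → levelAdj s b ≡ true × levelAdj s′ b ≡ false
  levelAdj-separates {zero}  {suc zero}    _ = suc zero , refl , refl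
  levelAdj-separates {zero}  {suc (suc c)} _ = zero , refl , refl
  levelAdj-separates {suc c} {suc c′} (s≤s c<c′) =
    inject₁ c , levelAdj-levelBelow (suc c) ,
    cong₂ _∨_ (⇒⌊⌋≡false (_ ≟ℕ _) far-below) (⇒⌊⌋≡false (_ ≟ℕ _) not-above)
    where
    far-below : toℕ (inject₁ c) ≢ suc (suc (toℕ c′))
    far-below e = <-irrefl e (subst (_< suc (suc (toℕ c′))) (sym (toℕ-inject₁ c)) (m<n⇒m<1+n (m<n⇒m<1+n c<c′)))
    not-above : suc (toℕ c′) ≢ suc (toℕ (inject₁ c))
    not-above e = >⇒≢ c<c′ (trans (suc-injectiveℕ e) (toℕ-inject₁ c))

  levelAdj-injective : ∀ {s s′} → (∀ b → levelAdj s b ≡ levelAdj s′ b) → s ≡ s′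
  levelAdj-injective {s} {s′} same with <-cmp s s′
  ... | tri≈ _ s≡s′ _ = s≡s′
  ... | tri< s<s′ _ _ with b , s~b , s′≁b ← levelAdj-separates s<s′ =
    contradiction (trans (sym s~b) (trans (same b) s′≁b)) λ ()
  ... | tri> _ _ s′<s with b , s′~b , s≁b ← levelAdj-separates s′<s =
    contradiction (trans (sym s′~b) (trans (sym (same b)) s≁b)) λ ()

  isTop : Fin (suc t) → Bool
  isTop s = ⌊ toℕ s ≟ℕ t ⌋

  middle : Fin (suc t) → Bool
  middle s = ⌊ 1 ≤ℕ? toℕ s ⌋ ∧ ⌊ toℕ s <ℕ? t ⌋

  ¬middle⇒bottom⊎top : ∀ s → middle s ≡ false → toℕ s ≡ 0 ⊎ toℕ s ≡ t
  ¬middle⇒bottom⊎top zero    _     = inj₁ refl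
  ¬middle⇒bottom⊎top (suc c) ¬mid = inj₂ (≤-antisym (toℕ<n c) (≮⇒≥ (⌊⌋≡false⇒ (suc (toℕ c) <ℕ? t) ¬mid)))

  ¬middle-isTop-injective : ∀ {s s′} → middle s ≡ false → middle s′ ≡ false → isTop s ≡ isTop s′ → s ≡ s′
  ¬middle-isTop-injective {s} {s′} ¬mid ¬mid′ top≡ =
    toℕ-injective (same-height (¬middle⇒bottom⊎top s ¬mid) (¬middle⇒bottom⊎top s′ ¬mid′))
    where
    same-height : toℕ s ≡ 0 ⊎ toℕ s ≡ t → toℕ s′ ≡ 0 ⊎ toℕ s′ ≡ t → toℕ s ≡ toℕ s′
    same-height (inj₁ e) (inj₁ e′) = trans e (sym e′)
    same-height (inj₂ e) (inj₂ e′) = trans e (sym e′)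
    same-height (inj₁ _) (inj₂ e′) = trans (⌊⌋≡true⇒ _ (trans top≡ (⇒⌊⌋≡true _ e′))) (sym e′)
    same-height (inj₂ e) (inj₁ _)  = trans e (sym (⌊⌋≡true⇒ _ (trans (sym top≡) (⇒⌊⌋≡true _ e))))

middle-top : ∀ t → middle (fromℕ t) ≡ false
middle-top t = trans (cong (⌊ 1 ≤ℕ? toℕ (fromℕ t) ⌋ ∧_) (⇒⌊⌋≡false (toℕ (fromℕ t) <ℕ? t) (<-irrefl (toℕ-fromℕ t))))
                     (∧-zeroʳ _)

middle-inner : ∀ {t} (s : Fin t) → middle {suc t} (suc (inject₁ s)) ≡ true
middle-inner s = ⇒⌊⌋≡true (suc (toℕ (inject₁ s)) <ℕ? _) (s≤s (subst (_< _) (sym (toℕ-inject₁ s)) (toℕ<n s)))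

isTop-inject₁ : ∀ {t} (s : Fin t) → isTop (inject₁ s) ≡ false
isTop-inject₁ s = ⇒⌊⌋≡false (toℕ (inject₁ s) ≟ℕ _) (toℕ-inject₁-≢ s ∘ sym)

module Mycielskian {n} (G : SimpleGraph n) (t : ℕ) where

  M : Adjacency (suc (suc t * n))
  M = mycielskian t G

  Level : Set
  Level = Fin (suc t)

  shadowAdj≡ : ∀ (s : Level) i (s′ : Level) j → shadowAdj G s i s′ j ≡ adj G i j ∧ levelAdj s s′
  shadowAdj≡ zero    i zero     j = refl
  shadowAdj≡ zero    i (suc _)  j = refl
  shadowAdj≡ (suc _) i zero     j = refl
  shadowAdj≡ (suc _) i (suc _)  j = refl

  M-shadow-apex : ∀ (s : Level) i → M (shadow s i) zero ≡ isTop s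
  M-shadow-apex s i = cong (λ p → ⌊ toℕ (proj₁ p) ≟ℕ t ⌋) (remQuot-combine s i)

  M-apex-shadow : ∀ (s : Level) i → M zero (shadow s i) ≡ isTop s
  M-apex-shadow s i = cong (λ p → ⌊ toℕ (proj₁ p) ≟ℕ t ⌋) (remQuot-combine s i)

  M-shadow-shadow : ∀ (s : Level) i (s′ : Level) j → M (shadow s i) (shadow s′ j) ≡ adj G i j ∧ levelAdj s s′
  M-shadow-shadow s i s′ j =
    trans (cong₂ (λ p q → shadowAdj G (proj₁ p) (proj₂ p) (proj₁ q) (proj₂ q))
                 (remQuot-combine s i) (remQuot-combine s′ j))
          (shadowAdj≡ s i s′ j)

  data Vertex : MycVertex t n → Set where
    apex    : Vertex zero
    shadowᵛ : ∀ (s : Level) i → Vertex (shadow s i)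

  view : ∀ x → Vertex x
  view zero    = apex
  view (suc x) = subst (Vertex ∘ suc) (combine-remQuot {suc t} n x) (shadowᵛ (quotient n x) (remainder {suc t} n x))

  shadow-injective : ∀ {s s′ : Level} {i j : Fin n} → shadow s i ≡ shadow s′ j → s ≡ s′ × i ≡ j
  shadow-injective {s} {s′} {i} {j} e = combine-injective s i s′ j (suc-injective e)

  same-neighbourhood : ∀ {x y} → M x zero ≡ M y zero → (∀ (s : Level) i → M x (shadow s i) ≡ M y (shadow s i))
                     → ∀ z → M x z ≡ M y z
  same-neighbourhood apex≡ shadow≡ z with view z
  ... | apex        = apex≡
  ... | shadowᵛ s i = shadow≡ s i

  apex-¬twin-shadow : ∀ (s : Level) j → ¬ Twins M zero (shadow s j)
  apex-¬twin-shadow s j (_ , same) = contradiction (begin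
    true                                   ≡⟨ sym (⇒⌊⌋≡true (toℕ (fromℕ t) ≟ℕ t) (toℕ-fromℕ t)) ⟩
    isTop (fromℕ t)                        ≡⟨ sym (M-apex-shadow (fromℕ t) j) ⟩
    M zero (shadow (fromℕ t) j)            ≡⟨ same (shadow (fromℕ t) j) ⟩
    M (shadow s j) (shadow (fromℕ t) j)    ≡⟨ M-shadow-shadow s j (fromℕ t) j ⟩
    adj G j j ∧ levelAdj s (fromℕ t)       ≡⟨ cong (_∧ levelAdj s (fromℕ t)) (irrefl G j) ⟩
    false                                  ∎) λ ()
    where open ≡-Reasoning

  twins⇒shadow-twins : ∀ {i j} (s : Level) → Twins (adj G) i j → Twins M (shadow s i) (shadow s j)
  twins⇒shadow-twins {i} {j} s (i≢j , same) =
    i≢j ∘ proj₂ ∘ shadow-injective {s} {s} ,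
    same-neighbourhood {shadow s i} {shadow s j} (trans (M-shadow-apex s i) (sym (M-shadow-apex s j)))
      (λ b z → trans (M-shadow-shadow s i b z) (trans (cong (_∧ levelAdj s b) (same z)) (sym (M-shadow-shadow s j b z))))

  low-isolated-shadows-twins : ∀ {s s′ : Fin t} {i j} → s ≢ s′ → Isolated (adj G) i → Isolated (adj G) j
                             → Twins M (shadow (inject₁ s) i) (shadow (inject₁ s′) j)
  low-isolated-shadows-twins {s} {s′} {i} {j} s≢s′ isoI isoJ =
    s≢s′ ∘ inject₁-injective ∘ proj₁ ∘ shadow-injective {inject₁ s} {inject₁ s′} ,
    same-neighbourhood {shadow (inject₁ s) i} {shadow (inject₁ s′) j}
      (trans (M-shadow-apex (inject₁ s) i)
        (trans (isTop-inject₁ s) (sym (trans (M-shadow-apex (inject₁ s′) j) (isTop-inject₁ s′)))))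
      (λ b z → trans (M-shadow-shadow (inject₁ s) i b z) (trans (cong (_∧ levelAdj (inject₁ s) b) (isoI z))
                 (sym (trans (M-shadow-shadow (inject₁ s′) j b z) (cong (_∧ levelAdj (inject₁ s′) b) (isoJ z))))))

  -- Through a neighbour k of i, equal neighbourhoods of the shadows factor into equal
  -- level adjacencies (hence equal levels) and equal neighbourhoods in G.
  shadow-twins⇒twins : ∀ {s : Level} {i} {s′ : Level} {j k} → adj G i k ≡ true → Twins M (shadow s i) (shadow s′ j)
                     → s ≡ s′ × Twins (adj G) i j
  shadow-twins⇒twins {s} {i} {s′} {j} aik (distinct , same)
    with adj≗ , level≗ ← ∧-factors-unique aik (levelAdj-levelBelow s)
           (λ z b → trans (sym (M-shadow-shadow s i b z)) (trans (same (shadow b z)) (M-shadow-shadow s′ j b z)))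
    with refl ← levelAdj-injective {s = s} {s′} level≗ = refl , (λ i≡j → distinct (cong (shadow s) i≡j)) , adj≗

  layer : Subset (suc (suc t * n)) → Level → Subset n
  layer S s = tabulate (λ i → lookup S (shadow s i))

  ∈layer⁺ : ∀ {S} {s : Level} {i} → shadow s i ∈ S → i ∈ layer S s
  ∈layer⁺ {S} {s} {i} ∈S = lookup⇒[]= i (layer S s) (trans (lookup∘tabulate _ i) ([]=⇒lookup ∈S))

  ∈layer⁻ : ∀ {S} {s : Level} {i} → i ∈ layer S s → shadow s i ∈ S
  ∈layer⁻ {S} {s} {i} ∈L = lookup⇒[]= (shadow s i) S (trans (sym (lookup∘tabulate _ i)) ([]=⇒lookup ∈L))

  layer-isTwinCover : ∀ {S} → IsTwinCover M S → ∀ s → IsTwinCover (adj G) (layer S s)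
  layer-isTwinCover cover s i j tw = Sum.map (∈layer⁺ {s = s}) (∈layer⁺ {s = s}) (cover _ _ (twins⇒shadow-twins s tw))

  sum-∣layer∣≤∣∣ : ∀ S → sum (λ s → ∣ layer S s ∣) ≤ ∣ S ∣
  sum-∣layer∣≤∣∣ (x ∷ v) = subst (_≤ ∣ x ∷ v ∣) (∣∣≡sum-∣slice∣ (suc t) v) (∣p∣≤∣x∷p∣ x v)

  ∣∣≡sum-∣layer∣ : ∀ v → ∣ outside ∷ v ∣ ≡ sum (λ s → ∣ layer (outside ∷ v) s ∣)
  ∣∣≡sum-∣layer∣ = ∣∣≡sum-∣slice∣ (suc t)

module CoverSet {n} (G : SimpleGraph n) (T : Subset n) (u : Fin n) (t : ℕ) where

  open Mycielskian G t

  C : Subset (suc (suc t * n))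
  C = coverSet t T u

  covered : Level × Fin n → Bool
  covered (s , i) = lookup T i ∨ (⌊ i Fin.≟ u ⌋ ∧ middle s)

  lookup-C-shadow : ∀ (s : Level) i → lookup C (shadow s i) ≡ covered (s , i)
  lookup-C-shadow s i =
    trans (lookup∘tabulate (covered ∘ remQuot n) (combine s i)) (cong covered (remQuot-combine s i))

  ∈T⇒∈C : ∀ {s : Level} {i} → i ∈ T → shadow s i ∈ C
  ∈T⇒∈C {s} {i} i∈T = lookup⇒[]= (shadow s i) C (trans (lookup-C-shadow s i) (cong (_∨ _) ([]=⇒lookup i∈T)))

  middle⇒∈C : ∀ {s : Level} → middle s ≡ true → shadow s u ∈ C
  middle⇒∈C {s} mid = lookup⇒[]= (shadow s u) C (trans (lookup-C-shadow s u)
    (trans (cong₂ (λ a b → lookup T u ∨ (a ∧ b)) (⇒⌊⌋≡true (u Fin.≟ u) refl) mid) (∨-zeroʳ _)))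

  ∉C⇒∉T : ∀ {s : Level} {i} → shadow s i ∉ C → i ∉ T
  ∉C⇒∉T {s} ∉C = ∉C ∘ ∈T⇒∈C {s}

  ∉C⇒¬middle : ∀ {s : Level} → shadow s u ∉ C → middle s ≡ false
  ∉C⇒¬middle ∉C = ¬-not (∉C ∘ middle⇒∈C)

  layer-C-outer : ∀ {s : Level} → middle s ≡ false → layer C s ≡ T
  layer-C-outer {s} ¬mid = trans (tabulate-cong only-T) (tabulate∘lookup T)
    where
    only-T : ∀ i → lookup C (shadow s i) ≡ lookup T i
    only-T i = begin
      lookup C (shadow s i)                      ≡⟨ lookup-C-shadow s i ⟩
      lookup T i ∨ (⌊ i Fin.≟ u ⌋ ∧ middle s)    ≡⟨ cong (λ b → lookup T i ∨ (⌊ i Fin.≟ u ⌋ ∧ b)) ¬mid ⟩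
      lookup T i ∨ (⌊ i Fin.≟ u ⌋ ∧ false)       ≡⟨ cong (lookup T i ∨_) (∧-zeroʳ _) ⟩
      lookup T i ∨ false                         ≡⟨ ∨-identityʳ _ ⟩
      lookup T i                                 ∎
      where open ≡-Reasoning

  ∣layer-C-inner∣ : u ∉ T → ∀ {s : Level} → middle s ≡ true → ∣ layer C s ∣ ≡ suc ∣ T ∣
  ∣layer-C-inner∣ u∉T {s} mid = ∣p∣≡1+∣q∣ (∈layer⁺ {s = s} (middle⇒∈C mid)) u∉T off-u
    where
    off-u : ∀ i → i ≢ u → lookup (layer C s) i ≡ lookup T i
    off-u i i≢u = trans (lookup∘tabulate _ i) (trans (lookup-C-shadow s i)
      (trans (cong (λ b → lookup T i ∨ (b ∧ middle s)) (⇒⌊⌋≡false (i Fin.≟ u) i≢u)) (∨-identityʳ _)))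

  module _ (T-cover : IsTwinCover (adj G) T) (isoU : Isolated (adj G) u) (u∉T : u ∉ T) where

    uncovered-shadows-not-twins : ∀ {s s′ : Level} {i j} → Twins M (shadow s i) (shadow s′ j)
                                → shadow s i ∉ C → shadow s′ j ∉ C → ⊥
    uncovered-shadows-not-twins {s} {s′} {i} {j} tw ∉C ∉C′
      with neighbour-or-isolated {A = adj G} i | neighbour-or-isolated {A = adj G} j
    ... | inj₁ (_ , aik) | _ with _ , twG ← shadow-twins⇒twins {s} {i} {s′} {j} aik tw =
      [ ∉C⇒∉T {s} ∉C , ∉C⇒∉T {s′} ∉C′ ]′ (T-cover i j twG)
    ... | inj₂ _ | inj₁ (_ , ajk) with _ , twG ← shadow-twins⇒twins {s′} {j} {s} {i} ajk (twins-sym {A = M} tw) =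
      [ ∉C⇒∉T {s′} ∉C′ , ∉C⇒∉T {s} ∉C ]′ (T-cover j i twG)
    ... | inj₂ isoI | inj₂ isoJ
      -- both vertices are shadows of u at levels 0 or t, and the apex tells these apart
      with refl ← uncovered-isolated-unique T-cover isoI isoU (∉C⇒∉T {s} ∉C) u∉T
      with refl ← uncovered-isolated-unique T-cover isoJ isoU (∉C⇒∉T {s′} ∉C′) u∉T =
      proj₁ tw (cong (λ l → shadow l u) (¬middle-isTop-injective (∉C⇒¬middle {s} ∉C) (∉C⇒¬middle {s′} ∉C′) top≡))
      where
      top≡ : isTop s ≡ isTop s′
      top≡ = trans (sym (M-shadow-apex s u)) (trans (proj₂ tw zero) (M-shadow-apex s′ u))

    uncovered-not-twins : ∀ {x y} → Twins M x y → x ∉ C → y ∉ C → ⊥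
    uncovered-not-twins {x} {y} tw x∉C y∉C with view x | view y
    ... | apex        | apex         = proj₁ tw refl
    ... | apex        | shadowᵛ s j  = apex-¬twin-shadow s j tw
    ... | shadowᵛ s i | apex         = apex-¬twin-shadow s i (twins-sym {A = M} tw)
    ... | shadowᵛ s i | shadowᵛ s′ j = uncovered-shadows-not-twins {s} {s′} {i} {j} tw x∉C y∉C

    coverSet-isTwinCover : IsTwinCover M C
    coverSet-isTwinCover x y tw with x ∈? C | y ∈? C
    ... | yes x∈C | _       = inj₁ x∈C
    ... | no  _   | yes y∈C = inj₂ y∈C
    ... | no  x∉C | no  y∉C = ⊥-elim (uncovered-not-twins tw x∉C y∉C)

module LowerBound {n} (G : SimpleGraph n) (t : ℕ) {T : Subset n} {u : Fin n}
  (minT : IsMinTwinCover (adj G) T) (isoU : Isolated (adj G) u) where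

  open Mycielskian G t

  module _ {S : Subset (suc (suc t * n))} (S-cover : IsTwinCover M S) where

    ∣T∣≤∣layer∣ : ∀ s → ∣ T ∣ ≤ ∣ layer S s ∣
    ∣T∣≤∣layer∣ s = proj₂ minT (layer S s) (layer-isTwinCover S-cover s)

    Deficient : Fin t → Set
    Deficient s = ∃ λ i → Isolated (adj G) i × i ∉ layer S (inject₁ s)

    deficient-unique : ∀ s s′ → Deficient s → Deficient s′ → s ≡ s′
    deficient-unique s s′ (i , isoI , i∉) (j , isoJ , j∉) with s Fin.≟ s′
    ... | yes s≡s′ = s≡s′
    ... | no  s≢s′ with S-cover _ _ (low-isolated-shadows-twins s≢s′ isoI isoJ)
    ...   | inj₁ ∈S = contradiction (∈layer⁺ {s = inject₁ s} ∈S) i∉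
    ...   | inj₂ ∈S = contradiction (∈layer⁺ {s = inject₁ s′} ∈S) j∉

    deficient-or-large : ∀ s → Deficient s ⊎ suc ∣ T ∣ ≤ ∣ layer S (inject₁ s) ∣
    deficient-or-large s with any? (λ i → isolated? {A = adj G} i ×-dec ¬? (i ∈? layer S (inject₁ s)))
    ... | yes deficient = inj₁ deficient
    ... | no  complete  =
      inj₂ (isolated⊆cover⇒∣T∣<∣S∣ minT isoU (layer-isTwinCover S-cover (inject₁ s)) isolated⊆layer)
      where
      isolated⊆layer : ∀ i → Isolated (adj G) i → i ∈ layer S (inject₁ s)
      isolated⊆layer i isoI = decidable-stable (i ∈? layer S (inject₁ s)) (λ i∉ → complete (i , isoI , i∉))

    ∣S∣-lowerBound : suc t * ∣ T ∣ + t ∸ 1 ≤ ∣ S ∣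
    ∣S∣-lowerBound = begin
      suc t * K + t ∸ 1                             ≡⟨ cong (_∸ 1) (regroup K t) ⟩
      t * suc K + K ∸ 1                             ≤⟨ ∸-monoˡ-≤ 1 (+-mono-≤ low-bound (∣T∣≤∣layer∣ (fromℕ t))) ⟩
      sum low + ∣ layer S (fromℕ t) ∣               ≡⟨ sym (sum-init-last (λ s → ∣ layer S s ∣)) ⟩
      sum (λ s → ∣ layer S s ∣)                     ≤⟨ sum-∣layer∣≤∣∣ S ⟩
      ∣ S ∣                                         ∎
      where
      open ≤-Reasoning
      K : ℕ
      K = ∣ T ∣
      low : Fin t → ℕ
      low s = ∣ layer S (inject₁ s) ∣
      low-bound : t * suc K ≤ suc (sum low)
      low-bound = sum-≥-exceptOne low K Deficient (∣T∣≤∣layer∣ ∘ inject₁) deficient-or-large deficient-unique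
      regroup : ∀ K t → suc t * K + t ≡ t * suc K + K
      regroup = solve 2 (λ K t → (con 1 :+ t) :* K :+ t := t :* (con 1 :+ K) :+ K) refl

∣coverSet∣ : ∀ {n} (G : SimpleGraph n) {T : Subset n} {u : Fin n} → u ∉ T
           → ∀ t′ → ∣ coverSet (suc t′) T u ∣ ≡ suc (suc t′) * ∣ T ∣ + suc t′ ∸ 1
∣coverSet∣ {n} G {T} {u} u∉T t′ = begin
  ∣ C ∣                                                       ≡⟨ ∣∣≡sum-∣layer∣ (tail C) ⟩
  ∣ layer C zero ∣ + sum (λ s → ∣ layer C (suc s) ∣)          ≡⟨ cong₂ _+_ (cong ∣_∣ (layer-C-outer {zero} refl))
                                                                           (sum-init-last (λ s → ∣ layer C (suc s) ∣)) ⟩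
  K + (sum (λ s → ∣ layer C (suc (inject₁ s)) ∣)
       + ∣ layer C (fromℕ (suc t′)) ∣)                        ≡⟨ cong (K +_) (cong₂ _+_ inner top) ⟩
  K + (t′ * suc K + K)                                        ≡⟨ regroup K t′ ⟩
  suc (suc t′) * K + t′                                       ≡⟨ cong (_∸ 1) (sym (+-suc (suc (suc t′) * K) t′)) ⟩
  suc (suc t′) * K + suc t′ ∸ 1                               ∎
  where
  open ≡-Reasoning
  open Mycielskian G (suc t′)
  open CoverSet G T u (suc t′)
  K : ℕ
  K = ∣ T ∣
  inner : sum (λ s → ∣ layer C (suc (inject₁ s)) ∣) ≡ t′ * suc K
  inner = trans (sum-cong-≗ (λ s → ∣layer-C-inner∣ u∉T {suc (inject₁ s)} (middle-inner s))) (sum-const t′ (suc K))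
  top : ∣ layer C (fromℕ (suc t′)) ∣ ≡ K
  top = cong ∣_∣ (layer-C-outer {fromℕ (suc t′)} (middle-top (suc t′)))
  regroup : ∀ K t′ → K + (t′ * suc K + K) ≡ suc (suc t′) * K + t′
  regroup = solve 2 (λ K t′ → K :+ (t′ :* (con 1 :+ K) :+ K) := (con 2 :+ t′) :* K :+ t′) refl

lemma3p14 : ∀ {n} (G : SimpleGraph n) (T : Subset n) (u : Fin n)
    → IsMinTwinCover (adj G) T
    → Isolated (adj G) u
    → u ∉ T
    → ∀ (t : ℕ) → 1 ≤ t
    → IsMinTwinCover (mycielskian t G) (coverSet t T u)
    × ∣ coverSet t T u ∣ ≡ suc t * ∣ T ∣ + t ∸ 1
lemma3p14 G T u minT isoU u∉T (suc t′) _ =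
  (coverSet-isTwinCover (proj₁ minT) isoU u∉T , minimal) , size
  where
  open CoverSet G T u (suc t′)
  open LowerBound G (suc t′) minT isoU
  size : ∣ C ∣ ≡ suc (suc t′) * ∣ T ∣ + suc t′ ∸ 1
  size = ∣coverSet∣ G u∉T t′
  minimal : ∀ S → IsTwinCover (mycielskian (suc t′) G) S → ∣ C ∣ ≤ ∣ S ∣
  minimal S S-cover = subst (_≤ ∣ S ∣) (sym size) (∣S∣-lowerBound S-cover)
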